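{- Let $t \geq 2$ be an integer and let $(H,\mathcal{F})$ be a $(3,t+1)$-system with $|\mathcal{F}|=s \geq 1$ such that every vertex of $H$ lies in at least one set of $\mathcal{F}$. Then either (a) there is a $(3,t)'$-system $(H',\mathcal{F}')$ such that $H$ is obtained from $H'$ by adding a new isolated vertex $v$ and $\mathcal{F}=\{S\cup\{v\} : S\in\mathcal{F}'\}$; or (b) there exists a $(3,t-1)'$-system $(H',\mathcal{F}')$ with $H'$ a subgraph of $H$ and $|\mathcal{F}'| \geq c s$, where $c>0$ is a constant depending only on $t$.
   Context: All graphs are finite and simple. For $t\ge1$, a $(3,t)'$-system is a pair $(H,\mathcal{F})$ where $H$ is a triangle-free graph and $\mathcal{F}$ is a family (without repeated elements) of subsets of $V(H)$, each of size exactly $t$, each of which is a maximal independent set of $H$. A $(3,t)$-system is a $(3,t)'$-system in which additionally any two distinct sets of $\mathcal{F}$ intersect. -}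

module Defs where

open import Data.Nat using (ℕ; suc; _*_; _≤_; _≥_)
open import Data.Fin using (Fin)
open import Data.Fin.Subset using (Subset; _∈_; _∉_; ∣_∣)
open import Data.List using (List; length)
open import Data.List.Membership.Propositional using () renaming (_∈_ to _∈ₗ_)
open import Data.List.Relation.Unary.Unique.Propositional using (Unique)
open import Data.Product using (Σ; ∃; ∃-syntax; _×_; _,_)
open import Data.Sum using (_⊎_)
open import Data.Empty using (⊥)
open import Relation.Nullary using (¬_)
open import Relation.Binary.PropositionalEquality using (_≡_; _≢_)
open import Function.Definitions using (Injective)

record Graph (n : ℕ) : Set₁ where
  field
    Adj     : Fin n → Fin n → Set
    sym     : ∀ {u v} → Adj u v → Adj v u
    irrefl  : ∀ {u} → ¬ Adj u u
open Graph public

TriangleFree : ∀ {n} → Graph n → Set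
TriangleFree G = ∀ a b c → Adj G a b → Adj G b c → Adj G a c → ⊥

Independent : ∀ {n} → Graph n → Subset n → Set
Independent G S = ∀ u v → u ∈ S → v ∈ S → ¬ Adj G u v

MaximalIndependent : ∀ {n} → Graph n → Subset n → Set
MaximalIndependent G S =
  Independent G S × (∀ v → v ∉ S → ∃[ u ] (u ∈ S × Adj G u v))

-- A family of subsets: a list without repeated elements.
-- (3,t)'-system
record System' (t : ℕ) {n : ℕ} (H : Graph n) (F : List (Subset n)) : Set where
  field
    triangleFree : TriangleFree H
    noRepeats    : Unique F
    size         : ∀ S → S ∈ₗ F → ∣ S ∣ ≡ t
    maxIndep     : ∀ S → S ∈ₗ F → MaximalIndependent H S

Intersecting : ∀ {n} → List (Subset n) → Set
Intersecting F = ∀ S T → S ∈ₗ F → T ∈ₗ F → S ≢ T → ∃[ x ] (x ∈ S × x ∈ T)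

System : (t : ℕ) {n : ℕ} (H : Graph n) (F : List (Subset n)) → Set
System t H F = System' t H F × Intersecting F

Covering : ∀ {n} → List (Subset n) → Set
Covering {n} F = ∀ (x : Fin n) → ∃[ S ] (S ∈ₗ F × x ∈ S)

-- The vertices of H' are identified with
-- V(H) ∖ {v} through an injection f whose image is exactly V(H) ∖ {v}.
ExtendByIsolated : ∀ {m n} → Graph m → List (Subset m) →
                   Graph n → List (Subset n) → Set
ExtendByIsolated {m} {n} H' F' H F =
  Σ (Fin n) λ v → Σ (Fin m → Fin n) λ f →
    Injective _≡_ _≡_ f
  × (∀ w → w ≢ v → ∃[ y ] (f y ≡ w))
  × (∀ y → f y ≢ v)
  × (∀ y z → (Adj H' y z → Adj H (f y) (f z)) × (Adj H (f y) (f z) → Adj H' y z))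
  × (∀ w → ¬ Adj H v w)
  × (∀ S → S ∈ₗ F → ∃[ S' ] (S' ∈ₗ F' × IsExt v f S' S))
  × (∀ S' → S' ∈ₗ F' → ∃[ S ] (S ∈ₗ F × IsExt v f S' S))
  where
  IsExt : Fin n → (Fin m → Fin n) → Subset m → Subset n → Set
  IsExt v f S' S = ∀ x → (x ∈ S → (x ≡ v ⊎ ∃[ y ] (y ∈ S' × f y ≡ x)))
                       × ((x ≡ v ⊎ ∃[ y ] (y ∈ S' × f y ≡ x)) → x ∈ S)

-- H' is a (not necessarily induced) subgraph of H: an injective map of
-- vertices preserving adjacency.
Subgraph : ∀ {m n} → Graph m → Graph n → Set
Subgraph {m} {n} H' H =
  Σ (Fin m → Fin n) λ f → Injective _≡_ _≡_ f × (∀ y z → Adj H' y z → Adj H (f y) (f z))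

{-# OPTIONS --safe #-}
module Submission where

-- If some vertex v lies in every set of F, then v is isolated (every vertex lies in
-- a set with v, and sets are independent), and deleting v gives alternative (a).
-- Otherwise fix S₀ ∈ F and, for every x, a set T x ∈ F missing x. Each S ∈ F
-- contains a pair {x , y} with x ∈ S ∩ S₀ and y ∈ S ∩ T x; as there are at most
-- (t+1)² such pairs, one pair K lies in at least |F|/(t+1)² sets. The link at K (these
-- sets minus K, on the graph induced by the vertices they cover outside K) is a
-- (3,t-1)'-system: a neighbour of a link vertex w cannot lie in K, because K and w
-- lie in a common independent set, so maximality passes to the link.

open import Defs
open import Data.Nat using (ℕ; suc; _+_; _*_; _∸_; _≤_; _≥_; z≤n; s≤s)
open import Data.Nat.Properties using (+-suc; +-mono-≤; ≤-trans; +-cancelˡ-≡; module ≤-Reasoning)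
open import Data.Fin using (Fin; zero; suc; _≟_)
open import Data.Fin.Properties using (suc-injective; any?)
open import Data.Fin.Subset
  using (Subset; inside; outside; Nonempty; _∈_; _∉_; _⊆_; ∣_∣; ⁅_⁆; _∪_; _─_; ⋃)
open import Data.Fin.Subset.Properties
  using (_∈?_; _⊆?_; ⊆-antisym; ∉⊥; nonempty?; Empty-unique; ∣⊥∣≡0; x∈⁅x⁆; x∈⁅y⁆⇒x≡y;
         ∣⁅x⁆∣≡1; x∈p∪q⁺; x∈p∪q⁻; ∪-identityˡ; ∪-identityʳ; p─q⊆p; x∈p∧x∉q⇒x∈p─q)
open import Data.Vec using ([]; _∷_; here; there)
open import Data.Vec.Properties using (∷-injective; ≡-dec)
open import Data.Bool.Properties using () renaming (_≟_ to _≟ᵇ_)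
open import Data.List using (List; []; _∷_; length; map; filter; concatMap)
open import Data.List.Properties using (length-map; length-++)
open import Data.List.Extrema.Nat using (argmax; argmax-all; f[xs]≤f[argmax])
open import Data.List.Membership.Propositional using (find; lose) renaming (_∈_ to _∈ₗ_)
open import Data.List.Membership.Propositional.Properties
  using (∈-map⁺; ∈-map⁻; ∈-filter⁻; ∈-concatMap⁺; ∈-concatMap⁻)
open import Data.List.Relation.Unary.Any as Any using (Any)
open import Data.List.Relation.Unary.All as All using (All)
open import Data.List.Relation.Unary.All.Properties using (¬All⇒Any¬) renaming (map⁺ to All-map⁺)
import Data.List.Relation.Unary.AllPairs as AllPairs
open import Data.List.Relation.Unary.Unique.Propositional using (Unique)
import Data.List.Relation.Unary.Unique.Propositional.Properties as Unique
open import Data.List.Relation.Binary.Sublist.Propositional.Properties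
  using (filter-⊆; filter⁺; length-mono-≤)
open import Data.Product using (Σ; ∃-syntax; _×_; _,_; proj₁; proj₂)
open import Data.Sum using (_⊎_; inj₁; inj₂) renaming (map to ⊎-map)
open import Function using (_∘_; id)
open import Function.Definitions using (Injective)
open import Relation.Nullary using (¬_; yes; no; ¬?; contradiction)
open import Relation.Unary using (Decidable)
open import Relation.Binary.PropositionalEquality as ≡ using (_≡_; _≢_; refl; cong; cong₂; subst)

private
  variable
    n : ℕ
    x y : Fin n
    p q : Subset n

x∈p─q⇒x∉q : x ∈ p ─ q → x ∉ q
x∈p─q⇒x∉q {p = _ ∷ _} {q = outside ∷ _} here ()
x∈p─q⇒x∉q {p = _ ∷ _} {q = _ ∷ _} (there x∈p─q) (there x∈q) = x∈p─q⇒x∉q x∈p─q x∈q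

x∈p⇒⁅x⁆⊆p : x ∈ p → ⁅ x ⁆ ⊆ p
x∈p⇒⁅x⁆⊆p {x = x} {p = p} x∈p z∈⁅x⁆ = subst (_∈ p) (≡.sym (x∈⁅y⁆⇒x≡y x z∈⁅x⁆)) x∈p

⁅x⁆∪⁅y⁆⊆p : x ∈ p → y ∈ p → ⁅ x ⁆ ∪ ⁅ y ⁆ ⊆ p
⁅x⁆∪⁅y⁆⊆p {x = x} {y = y} x∈p y∈p z∈ with x∈p∪q⁻ ⁅ x ⁆ ⁅ y ⁆ z∈
... | inj₁ z∈⁅x⁆ = x∈p⇒⁅x⁆⊆p x∈p z∈⁅x⁆
... | inj₂ z∈⁅y⁆ = x∈p⇒⁅x⁆⊆p y∈p z∈⁅y⁆

∣⁅x⁆∪⁅y⁆∣≡2 : ∀ (x y : Fin n) → x ≢ y → ∣ ⁅ x ⁆ ∪ ⁅ y ⁆ ∣ ≡ 2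
∣⁅x⁆∪⁅y⁆∣≡2 zero    zero    x≢y = contradiction refl x≢y
∣⁅x⁆∪⁅y⁆∣≡2 zero    (suc y) _   = cong suc (≡.trans (cong ∣_∣ (∪-identityˡ ⁅ y ⁆)) (∣⁅x⁆∣≡1 y))
∣⁅x⁆∪⁅y⁆∣≡2 (suc x) zero    _   = cong suc (≡.trans (cong ∣_∣ (∪-identityʳ ⁅ x ⁆)) (∣⁅x⁆∣≡1 x))
∣⁅x⁆∪⁅y⁆∣≡2 (suc x) (suc y) x≢y = ∣⁅x⁆∪⁅y⁆∣≡2 x y (x≢y ∘ cong suc)

x∈⋃⁺ : ∀ {ps : List (Subset n)} → p ∈ₗ ps → x ∈ p → x ∈ ⋃ ps
x∈⋃⁺ (Any.here refl) x∈p = x∈p∪q⁺ (inj₁ x∈p)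
x∈⋃⁺ (Any.there p∈ps) x∈p = x∈p∪q⁺ (inj₂ (x∈⋃⁺ p∈ps x∈p))

x∈⋃⁻ : ∀ (ps : List (Subset n)) → x ∈ ⋃ ps → ∃[ p ] (p ∈ₗ ps × x ∈ p)
x∈⋃⁻ []       x∈⊥ = contradiction x∈⊥ ∉⊥
x∈⋃⁻ (p ∷ ps) x∈⋃ with x∈p∪q⁻ p (⋃ ps) x∈⋃
... | inj₁ x∈p = p , Any.here refl , x∈p
... | inj₂ x∈⋃ps with x∈⋃⁻ ps x∈⋃ps
...   | q , q∈ps , x∈q = q , Any.there q∈ps , x∈q

∣p∣≡1+s⇒Nonempty : ∀ {n s} {p : Subset n} → ∣ p ∣ ≡ suc s → Nonempty p
∣p∣≡1+s⇒Nonempty {n} {p = p} ∣p∣≡1+s with nonempty? p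
... | yes p≢∅ = p≢∅
... | no  p≡∅ with () ← ≡.trans (≡.sym ∣p∣≡1+s) (≡.trans (cong ∣_∣ (Empty-unique p≡∅)) (∣⊥∣≡0 n))

elements : Subset n → List (Fin n)
elements []            = []
elements (inside  ∷ p) = zero ∷ map suc (elements p)
elements (outside ∷ p) = map suc (elements p)

length-elements : ∀ (p : Subset n) → length (elements p) ≡ ∣ p ∣
length-elements []            = refl
length-elements (inside  ∷ p) = cong suc (≡.trans (length-map suc (elements p)) (length-elements p))
length-elements (outside ∷ p) = ≡.trans (length-map suc (elements p)) (length-elements p)

∈-elements⁺ : x ∈ p → x ∈ₗ elements p
∈-elements⁺ {p = inside  ∷ p} here            = Any.here refl
∈-elements⁺ {p = inside  ∷ p} (there x∈p) = Any.there (∈-map⁺ suc (∈-elements⁺ x∈p))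
∈-elements⁺ {p = outside ∷ p} (there x∈p) = ∈-map⁺ suc (∈-elements⁺ x∈p)

∈-elements⁻ : x ∈ₗ elements p → x ∈ p
∈-elements⁻ {p = inside  ∷ p} (Any.here refl) = here
∈-elements⁻ {p = inside  ∷ p} (Any.there x∈) with ∈-map⁻ suc x∈
... | _ , y∈ , refl = there (∈-elements⁻ y∈)
∈-elements⁻ {p = outside ∷ p} x∈ with ∈-map⁻ suc x∈
... | _ , y∈ , refl = there (∈-elements⁻ y∈)

unique-map⁺ : ∀ {A B : Set} {f : A → B} {xs : List A} →
              (∀ {a b} → a ∈ₗ xs → b ∈ₗ xs → f a ≡ f b → a ≡ b) →
              Unique xs → Unique (map f xs)
unique-map⁺ f-inj AllPairs.[] = AllPairs.[]
unique-map⁺ f-inj (a∉xs AllPairs.∷ xs!) =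
  All-map⁺ (All.tabulate λ b∈xs fa≡fb → All.lookup a∉xs b∈xs (f-inj (Any.here refl) (Any.there b∈xs) fa≡fb))
    AllPairs.∷ unique-map⁺ (λ a∈ b∈ → f-inj (Any.there a∈) (Any.there b∈)) xs!

length-concatMap : ∀ {A B : Set} (f : A → List B) {c} → (∀ a → length (f a) ≡ c) →
                   ∀ xs → length (concatMap f xs) ≡ length xs * c
length-concatMap f f-len []       = refl
length-concatMap f f-len (a ∷ xs) =
  ≡.trans (length-++ (f a)) (cong₂ _+_ (f-len a) (length-concatMap f f-len xs))

length-filter-∁ : ∀ {A : Set} {P : A → Set} (P? : Decidable P) (xs : List A) →
                  length (filter P? xs) + length (filter (¬? ∘ P?) xs) ≡ length xs
length-filter-∁ P? [] = refl
length-filter-∁ P? (a ∷ xs) with P? a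
... | yes _ = cong suc (length-filter-∁ P? xs)
... | no  _ = ≡.trans (+-suc _ _) (cong suc (length-filter-∁ P? xs))

module _ {A B : Set} {R : B → A → Set} (R? : ∀ b → Decidable (R b)) where

  count : B → List A → ℕ
  count b L = length (filter (R? b) L)

  count-filter-≤ : ∀ {P : A → Set} (P? : Decidable P) b L → count b (filter P? L) ≤ count b L
  count-filter-≤ P? b L = length-mono-≤ (filter⁺ (R? b) (R? b) (λ { refl → id }) (filter-⊆ P? L))

  covering-bound : ∀ (Q : List B) (L : List A) m →
                   (∀ {a} → a ∈ₗ L → Any (λ b → R b a) Q) →
                   All (λ b → count b L ≤ m) Q →
                   length L ≤ length Q * m
  covering-bound []      []      m _ _ = z≤n
  covering-bound []      (a ∷ L) m cover _ with () ← cover (Any.here refl)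
  covering-bound (q ∷ Q) L m cover (count-q≤m All.∷ counts≤m) = begin
    length L                ≡⟨ length-filter-∁ (R? q) L ⟨
    count q L + length rest ≤⟨ +-mono-≤ count-q≤m (covering-bound Q rest m rest-cover counts-rest≤m) ⟩
    m + length Q * m        ∎
    where
    open ≤-Reasoning
    rest : List A
    rest = filter (¬? ∘ R? q) L
    rest-cover : ∀ {a} → a ∈ₗ rest → Any (λ b → R b a) Q
    rest-cover a∈rest with ∈-filter⁻ (¬? ∘ R? q) a∈rest
    ... | a∈L , ¬Rqa = Any.tail ¬Rqa (cover a∈L)
    counts-rest≤m : All (λ b → count b rest ≤ m) Q
    counts-rest≤m = All.map (λ {b} → ≤-trans (count-filter-≤ (¬? ∘ R? q) b L)) counts≤m

  pigeonhole : ∀ {b₀} (Q : List B) (L : List A) → b₀ ∈ₗ Q →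
               (∀ {a} → a ∈ₗ L → Any (λ b → R b a) Q) →
               ∃[ b ] (b ∈ₗ Q × length L ≤ length Q * count b L)
  pigeonhole {b₀} Q L b₀∈Q cover =
    b , argmax-all (λ b → count b L) b₀∈Q (All.tabulate id) ,
    covering-bound Q L (count b L) cover (f[xs]≤f[argmax] b₀ Q)
    where
    b : B
    b = argmax (λ b → count b L) b₀ Q

embed : ∀ (p : Subset n) → Fin ∣ p ∣ → Fin n
embed (inside  ∷ p) zero    = zero
embed (inside  ∷ p) (suc i) = suc (embed p i)
embed (outside ∷ p) i       = suc (embed p i)

embed-injective : ∀ (p : Subset n) → Injective _≡_ _≡_ (embed p)
embed-injective (inside  ∷ p) {zero}  {zero}  _ = refl
embed-injective (inside  ∷ p) {suc i} {suc j} e = cong suc (embed-injective p (suc-injective e))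
embed-injective (outside ∷ p)                 e = embed-injective p (suc-injective e)

embed-∈ : ∀ (p : Subset n) i → embed p i ∈ p
embed-∈ (inside  ∷ p) zero    = here
embed-∈ (inside  ∷ p) (suc i) = there (embed-∈ p i)
embed-∈ (outside ∷ p) i       = there (embed-∈ p i)

embed-surjective : x ∈ p → ∃[ i ] (embed p i ≡ x)
embed-surjective {p = inside  ∷ p} here        = zero , refl
embed-surjective {p = inside  ∷ p} (there x∈p) with embed-surjective x∈p
... | i , refl = suc i , refl
embed-surjective {p = outside ∷ p} (there x∈p) with embed-surjective x∈p
... | i , refl = i , refl

-- restrict q p is p ∩ q, seen as a subset of q through embed q.
restrict : ∀ (q : Subset n) → Subset n → Subset ∣ q ∣
restrict []            []      = []
restrict (inside  ∷ q) (s ∷ p) = s ∷ restrict q p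
restrict (outside ∷ q) (_ ∷ p) = restrict q p

∈-restrict⁺ : ∀ (q : Subset n) {p i} → embed q i ∈ p → i ∈ restrict q p
∈-restrict⁺ (inside  ∷ q) {_ ∷ _} {zero}  here        = here
∈-restrict⁺ (inside  ∷ q) {_ ∷ _} {suc i} (there x∈p) = there (∈-restrict⁺ q x∈p)
∈-restrict⁺ (outside ∷ q) {_ ∷ _}         (there x∈p) = ∈-restrict⁺ q x∈p

∈-restrict⁻ : ∀ (q : Subset n) {p i} → i ∈ restrict q p → embed q i ∈ p
∈-restrict⁻ (inside  ∷ q) {_ ∷ _} {zero}  here        = here
∈-restrict⁻ (inside  ∷ q) {_ ∷ _} {suc i} (there i∈)  = there (∈-restrict⁻ q i∈)
∈-restrict⁻ (outside ∷ q) {_ ∷ _}         i∈          = there (∈-restrict⁻ q i∈)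

∣p─q∣+∣restrict∣≡∣p∣ : ∀ (p q : Subset n) → ∣ p ─ q ∣ + ∣ restrict q p ∣ ≡ ∣ p ∣
∣p─q∣+∣restrict∣≡∣p∣ []            []            = refl
∣p─q∣+∣restrict∣≡∣p∣ (inside  ∷ p) (inside  ∷ q) =
  ≡.trans (+-suc _ _) (cong suc (∣p─q∣+∣restrict∣≡∣p∣ p q))
∣p─q∣+∣restrict∣≡∣p∣ (outside ∷ p) (inside  ∷ q) = ∣p─q∣+∣restrict∣≡∣p∣ p q
∣p─q∣+∣restrict∣≡∣p∣ (inside  ∷ p) (outside ∷ q) = cong suc (∣p─q∣+∣restrict∣≡∣p∣ p q)
∣p─q∣+∣restrict∣≡∣p∣ (outside ∷ p) (outside ∷ q) = ∣p─q∣+∣restrict∣≡∣p∣ p q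

restrict-injective : ∀ (q : Subset n) {p₁ p₂} →
                     p₁ ─ q ≡ p₂ ─ q → restrict q p₁ ≡ restrict q p₂ → p₁ ≡ p₂
restrict-injective []            {[]}    {[]}    _ _ = refl
restrict-injective (inside  ∷ q) {_ ∷ _} {_ ∷ _} outside≡ restrict≡ with ∷-injective restrict≡
... | s₁≡s₂ , tails≡ = cong₂ _∷_ s₁≡s₂ (restrict-injective q (proj₂ (∷-injective outside≡)) tails≡)
restrict-injective (outside ∷ q) {_ ∷ _} {_ ∷ _} outside≡ restrict≡ with ∷-injective outside≡
... | s₁≡s₂ , tails≡ = cong₂ _∷_ s₁≡s₂ (restrict-injective q tails≡ restrict≡)

induced : Graph n → (p : Subset n) → Graph ∣ p ∣
induced H p = record
  { Adj    = λ i j → Adj H (embed p i) (embed p j)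
  ; sym    = sym H
  ; irrefl = irrefl H
  }

filter-system' : ∀ {t} {H : Graph n} {F : List (Subset n)} {P : Subset n → Set} (P? : Decidable P) →
                 System' t H F → System' t H (filter P? F)
filter-system' P? sys = record
  { triangleFree = triangleFree
  ; noRepeats    = Unique.filter⁺ P? noRepeats
  ; size         = λ S → size S ∘ proj₁ ∘ ∈-filter⁻ P?
  ; maxIndep     = λ S → maxIndep S ∘ proj₁ ∘ ∈-filter⁻ P?
  }
  where open System' sys

module Link (H : Graph n) (K : Subset n) (G : List (Subset n)) where

  vertices : Subset n
  vertices = ⋃ G ─ K

  graph : Graph ∣ vertices ∣
  graph = induced H vertices

  family : List (Subset ∣ vertices ∣)
  family = map (restrict vertices) G

  x∈K⇒x∉vertices : x ∈ K → x ∉ vertices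
  x∈K⇒x∉vertices x∈K x∈vertices = x∈p─q⇒x∉q x∈vertices x∈K

  x∈vertices⁺ : ∀ {S} → S ∈ₗ G → x ∈ S → x ∉ K → x ∈ vertices
  x∈vertices⁺ S∈G x∈S = x∈p∧x∉q⇒x∈p─q (x∈⋃⁺ S∈G x∈S)

  length-family : length family ≡ length G
  length-family = length-map (restrict vertices) G

  embed-subgraph : Subgraph graph H
  embed-subgraph = embed vertices , embed-injective vertices , λ _ _ → id

  module _ {s} (sys : System' s H G) (K⊆G : ∀ S → S ∈ₗ G → K ⊆ S) where
    open System' sys

    K-nonadjacent : ∀ {z w} → z ∈ K → w ∈ vertices → ¬ Adj H z w
    K-nonadjacent z∈K w∈vertices with x∈⋃⁻ G (p─q⊆p _ _ w∈vertices)
    ... | S , S∈G , w∈S = proj₁ (maxIndep S S∈G) _ _ (K⊆G S S∈G z∈K) w∈S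

    S─vertices≡K : ∀ {S} → S ∈ₗ G → S ─ vertices ≡ K
    S─vertices≡K {S} S∈G = ⊆-antisym ⊆K K⊆
      where
      ⊆K : S ─ vertices ⊆ K
      ⊆K {x} x∈ with x ∈? K
      ... | yes x∈K = x∈K
      ... | no  x∉K = contradiction (x∈vertices⁺ S∈G (p─q⊆p _ _ x∈) x∉K) (x∈p─q⇒x∉q x∈)
      K⊆ : K ⊆ S ─ vertices
      K⊆ x∈K = x∈p∧x∉q⇒x∈p─q (K⊆G S S∈G x∈K) (x∈K⇒x∉vertices x∈K)

    ∀-family : ∀ {P : Subset ∣ vertices ∣ → Set} →
               (∀ {S} → S ∈ₗ G → P (restrict vertices S)) → ∀ S' → S' ∈ₗ family → P S'
    ∀-family P-G S' S'∈ with ∈-map⁻ (restrict vertices) S'∈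
    ... | S , S∈G , refl = P-G S∈G

    restrict-size : ∀ {k} → ∣ K ∣ + k ≡ s → ∀ {S} → S ∈ₗ G → ∣ restrict vertices S ∣ ≡ k
    restrict-size {k} ∣K∣+k≡s {S} S∈G = +-cancelˡ-≡ ∣ K ∣ _ _ (begin
      ∣ K ∣ + ∣ restrict vertices S ∣
        ≡⟨ cong (λ K′ → ∣ K′ ∣ + ∣ restrict vertices S ∣) (S─vertices≡K S∈G) ⟨
      ∣ S ─ vertices ∣ + ∣ restrict vertices S ∣ ≡⟨ ∣p─q∣+∣restrict∣≡∣p∣ S vertices ⟩
      ∣ S ∣                                     ≡⟨ size S S∈G ⟩
      s                                         ≡⟨ ∣K∣+k≡s ⟨
      ∣ K ∣ + k                                 ∎)
      where open ≡.≡-Reasoning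

    restrict-maximal : ∀ {S} → S ∈ₗ G → MaximalIndependent graph (restrict vertices S)
    restrict-maximal {S} S∈G = independent , maximal
      where
      independent : Independent graph (restrict vertices S)
      independent _ _ i∈ j∈ =
        proj₁ (maxIndep S S∈G) _ _ (∈-restrict⁻ vertices i∈) (∈-restrict⁻ vertices j∈)
      maximal : ∀ i → i ∉ restrict vertices S → ∃[ j ] (j ∈ restrict vertices S × Adj graph j i)
      maximal i i∉ with proj₂ (maxIndep S S∈G) (embed vertices i) (i∉ ∘ ∈-restrict⁺ vertices)
      ... | z , z∈S , z~i
        with embed-surjective (x∈vertices⁺ S∈G z∈S λ z∈K → K-nonadjacent z∈K (embed-∈ vertices i) z~i)
      ...   | j , refl = j , ∈-restrict⁺ vertices z∈S , z~i

    system' : ∀ {k} → ∣ K ∣ + k ≡ s → System' k graph family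
    system' ∣K∣+k≡s = record
      { triangleFree = λ i j k → triangleFree (embed vertices i) (embed vertices j) (embed vertices k)
      ; noRepeats    = unique-map⁺ restrict-injectiveOn noRepeats
      ; size         = ∀-family (restrict-size ∣K∣+k≡s)
      ; maxIndep     = ∀-family restrict-maximal
      }
      where
      restrict-injectiveOn : ∀ {S T} → S ∈ₗ G → T ∈ₗ G →
                             restrict vertices S ≡ restrict vertices T → S ≡ T
      restrict-injectiveOn S∈G T∈G =
        restrict-injective vertices (≡.trans (S─vertices≡K S∈G) (≡.sym (S─vertices≡K T∈G)))

popular-pair : ∀ {s} {F : List (Subset n)} {S₀} → S₀ ∈ₗ F → Intersecting F →
               (∀ S → S ∈ₗ F → ∣ S ∣ ≡ suc s) → (∀ x → ∃[ T ] (T ∈ₗ F × x ∉ T)) →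
               ∃[ K ] (∣ K ∣ ≡ 2 × length F ≤ (suc s * suc s) * length (filter (K ⊆?_) F))
popular-pair {n} {s} {F} {S₀} S₀∈F intersecting size avoid =
  let K , K∈pairs , bound = pigeonhole (_⊆?_) pairs F (proj₁ (proj₂ (find (cover S₀∈F)))) cover
  in  K , pair-size K∈pairs ,
      subst (λ l → length F ≤ l * length (filter (K ⊆?_) F)) length-pairs bound
  where
  T : Fin n → Subset n
  T x = proj₁ (avoid x)

  T∈F : ∀ x → T x ∈ₗ F
  T∈F x = proj₁ (proj₂ (avoid x))

  x∉T : ∀ x → x ∉ T x
  x∉T x = proj₂ (proj₂ (avoid x))

  pairs-at : Fin n → List (Subset n)
  pairs-at x = map (λ y → ⁅ x ⁆ ∪ ⁅ y ⁆) (elements (T x))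

  pairs : List (Subset n)
  pairs = concatMap pairs-at (elements S₀)

  length-pairs : length pairs ≡ suc s * suc s
  length-pairs = begin
    length pairs                     ≡⟨ length-concatMap pairs-at length-pairs-at (elements S₀) ⟩
    length (elements S₀) * suc s     ≡⟨ cong (_* suc s) (≡.trans (length-elements S₀) (size S₀ S₀∈F)) ⟩
    suc s * suc s                    ∎
    where
    open ≡.≡-Reasoning
    length-pairs-at : ∀ x → length (pairs-at x) ≡ suc s
    length-pairs-at x = ≡.trans (length-map _ (elements (T x)))
      (≡.trans (length-elements (T x)) (size (T x) (T∈F x)))

  pair-size : ∀ {K} → K ∈ₗ pairs → ∣ K ∣ ≡ 2
  pair-size K∈ with find (∈-concatMap⁻ pairs-at {xs = elements S₀} K∈)
  ... | x , _ , K∈pairs-at with ∈-map⁻ _ K∈pairs-at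
  ...   | y , y∈T , refl = ∣⁅x⁆∪⁅y⁆∣≡2 x y λ { refl → x∉T x (∈-elements⁻ y∈T) }

  meets-S₀ : ∀ {S} → S ∈ₗ F → ∃[ x ] (x ∈ S × x ∈ S₀)
  meets-S₀ {S} S∈F with ≡-dec _≟ᵇ_ S S₀
  ... | no  S≢S₀ = intersecting S S₀ S∈F S₀∈F S≢S₀
  ... | yes refl with ∣p∣≡1+s⇒Nonempty (size S S∈F)
  ...   | x , x∈S = x , x∈S , x∈S

  cover : ∀ {S} → S ∈ₗ F → Any (_⊆ S) pairs
  cover {S} S∈F with meets-S₀ S∈F
  ... | x , x∈S , x∈S₀ with intersecting S (T x) S∈F (T∈F x) (λ { refl → x∉T x x∈S })
  ...   | y , y∈S , y∈T =
    lose (∈-concatMap⁺ pairs-at (lose (∈-elements⁺ x∈S₀) (∈-map⁺ _ (∈-elements⁺ y∈T))))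
         (⁅x⁆∪⁅y⁆⊆p x∈S y∈S)

common-vertex? : ∀ (F : List (Subset n)) →
                 (∃[ v ] (∀ S → S ∈ₗ F → v ∈ S)) ⊎ (∀ x → ∃[ T ] (T ∈ₗ F × x ∉ T))
common-vertex? F with any? (λ v → All.all? (v ∈?_) F)
... | yes (v , v∈F) = inj₁ (v , λ _ → All.lookup v∈F)
... | no  ¬common   = inj₂ λ x → find (¬All⇒Any¬ (x ∈?_) F λ x∈F → ¬common (x , x∈F))

common-vertex-isolated : ∀ {H : Graph n} {F v} →
  Covering F → (∀ S → S ∈ₗ F → Independent H S) → (∀ S → S ∈ₗ F → v ∈ S) → ∀ w → ¬ Adj H v w
common-vertex-isolated cover independent v∈F w v~w with cover w
... | S , S∈F , w∈S = independent S S∈F _ _ (v∈F S S∈F) w∈S v~w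

remove-common-vertex : ∀ {t} {H : Graph n} {F v} →
  System' (suc t) H F → Covering F → (∀ S → S ∈ₗ F → v ∈ S) →
  Σ ℕ λ m → Σ (Graph m) λ H' → Σ (List (Subset m)) λ F' →
    System' t H' F' × ExtendByIsolated H' F' H F
remove-common-vertex {n} {t} {H} {F} {v} sys cover v∈F =
  _ , graph , family ,
  system' sys (λ S → x∈p⇒⁅x⁆⊆p ∘ v∈F S) (cong (_+ t) (∣⁅x⁆∣≡1 v)) ,
  ( v , embed vertices , embed-injective vertices
  , (λ w w≢v → embed-surjective (w∈vertices w≢v))
  , (λ i embed≡v → x∈K⇒x∉vertices (x∈⁅x⁆ v) (subst (_∈ vertices) embed≡v (embed-∈ vertices i)))
  , (λ _ _ → id , id)
  , common-vertex-isolated {H = H} cover (λ S → proj₁ ∘ maxIndep S) v∈F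
  , (λ S S∈F → restrict vertices S , ∈-map⁺ _ S∈F , decomposition S∈F)
  , λ S' S'∈ → let S , S∈F , S'≡ = ∈-map⁻ _ S'∈ in
                S , S∈F , subst (λ S' → Extends S' S) (≡.sym S'≡) (decomposition S∈F))
  where
  open Link H ⁅ v ⁆ F
  open System' sys

  w∈vertices : ∀ {w} → w ≢ v → w ∈ vertices
  w∈vertices {w} w≢v =
    let S , S∈F , w∈S = cover w in x∈vertices⁺ S∈F w∈S (w≢v ∘ x∈⁅y⁆⇒x≡y v)

  Extends : Subset ∣ vertices ∣ → Subset n → Set
  Extends S' S = ∀ x → (x ∈ S → x ≡ v ⊎ ∃[ i ] (i ∈ S' × embed vertices i ≡ x))
                     × (x ≡ v ⊎ ∃[ i ] (i ∈ S' × embed vertices i ≡ x) → x ∈ S)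

  decomposition : ∀ {S} → S ∈ₗ F → Extends (restrict vertices S) S
  decomposition {S} S∈F x = to , from
    where
    to : x ∈ S → x ≡ v ⊎ ∃[ i ] (i ∈ restrict vertices S × embed vertices i ≡ x)
    to x∈S with x ≟ v
    ... | yes x≡v = inj₁ x≡v
    ... | no  x≢v with embed-surjective (w∈vertices x≢v)
    ...   | i , refl = inj₂ (i , ∈-restrict⁺ vertices x∈S , refl)
    from : x ≡ v ⊎ ∃[ i ] (i ∈ restrict vertices S × embed vertices i ≡ x) → x ∈ S
    from (inj₁ refl)            = v∈F S S∈F
    from (inj₂ (i , i∈ , refl)) = ∈-restrict⁻ vertices i∈

link-of-popular-pair : ∀ {t} {H : Graph n} {F S₀} → System (suc (suc t)) H F → S₀ ∈ₗ F →
  (∀ x → ∃[ T ] (T ∈ₗ F × x ∉ T)) →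
  Σ ℕ λ m → Σ (Graph m) λ H' → Σ (List (Subset m)) λ F' →
    System' t H' F' × Subgraph H' H × length F ≤ (suc (suc t) * suc (suc t)) * length F'
link-of-popular-pair {t = t} {H} {F} (sys , intersecting) S₀∈F avoid
  with popular-pair S₀∈F intersecting (System'.size sys) avoid
... | K , ∣K∣≡2 , bound =
  _ , graph , family ,
  system' (filter-system' (K ⊆?_) sys) (λ _ → proj₂ ∘ ∈-filter⁻ (K ⊆?_) {xs = F})
          (cong (_+ t) ∣K∣≡2) ,
  embed-subgraph ,
  subst (λ l → length F ≤ (suc (suc t) * suc (suc t)) * l) (≡.sym length-family) bound
  where open Link H K (filter (K ⊆?_) F)

-- The hypothesis t ≥ 2 only serves to rule out t = 0.
lemma33 : ∀ (t : ℕ) → t ≥ 2 →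
    Σ ℕ λ d → d ≥ 1 ×
      (∀ (n : ℕ) (H : Graph n) (F : List (Subset n)) →
        System (suc t) H F → length F ≥ 1 → Covering F →
        (Σ ℕ λ m → Σ (Graph m) λ H' → Σ (List (Subset m)) λ F' →
           System' t H' F' × ExtendByIsolated H' F' H F)
        ⊎
        (Σ ℕ λ m → Σ (Graph m) λ H' → Σ (List (Subset m)) λ F' →
           System' (t ∸ 1) H' F' × Subgraph H' H × length F ≤ d * length F'))
lemma33 (suc t) _ = suc (suc t) * suc (suc t) , s≤s z≤n , λ where
  n H (S₀ ∷ F) (sys , intersecting) _ cover →
    ⊎-map (λ (_ , v∈F) → remove-common-vertex sys cover v∈F)
          (link-of-popular-pair (sys , intersecting) (Any.here refl))
          (common-vertex? (S₀ ∷ F))
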